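{- For each integer $b\geq 2$, there are at least $(b^2+b)/2$ values of $\epsilon\in\{0,1,\dots,b^2-1\}$ for which $F(b^2,\epsilon)\le b+2$.
   Context: The function $F:\mathbb Z_{>0}\times\mathbb Z_{\ge0}\to\mathbb Z_{>0}$ is defined as follows. Given $x_1>0$ and $x_2\ge 0$, for each $i\ge2$ with $x_i>0$ let $x_{i+1}$ be the least nonnegative residue of $-x_{i-1}$ modulo $x_i$; $F(x_1,x_2)$ is the number of positive terms in the sequence $(x_i)$. In particular $F(x,0)=1$. -}

module Defs where

open import Data.Nat using (ℕ; zero; suc; _+_; _*_; _∸_; _≤_; _<_; _%_; _≡ᵇ_)
open import Data.Bool using (true; false; if_then_else_)
open import Data.List using (List; filter; length; upTo)
open import Relation.Nullary.Decidable using (Dec)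
open import Data.Nat using (_≤?_)

-- least nonnegative residue of -a modulo b (for b > 0):  (b ∸ a % b) % b
negMod : ℕ → (b : ℕ) → ℕ
negMod a zero    = 0
negMod a (suc k) = (suc k ∸ a % suc k) % suc k

-- tail a b fuel : number of positive terms among x_i, x_{i+1}, ... where
-- x_{i-1} = a, x_i = b.  Since 0 ≤ x_{i+1} < x_i whenever x_i > 0, the
-- sequence reaches 0 after at most b+1 steps, so fuel b+1 is sufficient.
posTail : ℕ → ℕ → ℕ → ℕ
posTail zero     a b       = 0
posTail (suc n)  a zero    = 0
posTail (suc n)  a (suc k) = suc (posTail n (suc k) (negMod a (suc k)))

-- F(x1, x2) = number of positive terms of the sequence (x_i); defined for x1 > 0
-- (x1 itself counts as one positive term).
F : ℕ → ℕ → ℕ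
F x₁ x₂ = suc (posTail (suc x₂) x₁ x₂)

goodCount : ℕ → ℕ
goodCount b = length (filter (λ ε → F (b * b) ε ≤? b + 2) (upTo (b * b)))

-- Write N = y + d with y, d > 0.  If y < d, the sequence for (N, d) steps to (y + s, s) with
-- s = d ∸ y, and the one for (N, y) has the same length as the one for (y + s, y); this is one
-- step of the subtractive Euclidean algorithm, and induction gives
-- (F N y − 1)(F N (N ∸ y) − 1) < N.  For N = b² one of ε and b² ∸ ε is therefore good, and
-- both are when ε is a multiple of b, since the sequence for (b², j b) is b times the one for
-- (b, j).  Summing over ε < b² counts every good ε at most twice and gives b² + b ≤ 2 goodCount b.
module Submission where

open import Defs
open import Data.Nat using (ℕ; _+_; _*_; _≤_; _/_)
open import Data.Nat
  using (zero; suc; _∸_; _<_; _≤?_; z≤n; s≤s; z<s; s<s; compare; less; equal; greater)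
open import Data.Nat.Properties
open import Data.Nat.DivMod
open import Data.Nat.Induction using (<-wellFounded)
open import Data.Nat.Tactic.RingSolver using (solve-∀)
open import Data.Bool using (true; false; if_then_else_)
open import Data.List using (filter; length; applyUpTo)
open import Data.Sum using (_⊎_; inj₁; inj₂)
open import Function using (_∘_; id)
open import Induction.WellFounded using (Acc; acc)
open import Relation.Nullary using (Dec; yes; no; does; ¬_; contradiction)
open import Relation.Unary using (Pred; Decidable)
open import Relation.Binary.PropositionalEquality

negMod-< : ∀ a k → negMod a (suc k) < suc k
negMod-< a k = m%n<n (suc k ∸ a % suc k) (suc k)

negMod-+ˡ : ∀ y a → negMod (y + a) y ≡ negMod a y
negMod-+ˡ zero    a = refl
negMod-+ˡ (suc k) a = cong (λ r → (suc k ∸ r) % suc k)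
  (trans (cong (_% suc k) (+-comm (suc k) a)) ([m+n]%n≡m%n a (suc k)))

negMod-self : ∀ y → negMod y y ≡ 0
negMod-self zero    = refl
negMod-self (suc k) = trans (cong (λ r → (suc k ∸ r) % suc k) (n%n≡0 (suc k))) (n%n≡0 (suc k))

negMod-+ : ∀ a m → 0 < a → a < m → negMod (a + m) m ≡ m ∸ a
negMod-+ a m@(suc k) 0<a a<m = begin
  (m ∸ (a + m) % m) % m ≡⟨ cong (λ r → (m ∸ r) % m) ([m+n]%n≡m%n a m) ⟩
  (m ∸ a % m) % m       ≡⟨ cong (λ r → (m ∸ r) % m) (m<n⇒m%n≡m a<m) ⟩
  (m ∸ a) % m           ≡⟨ m<n⇒m%n≡m (∸-monoʳ-< 0<a (<⇒≤ a<m)) ⟩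
  m ∸ a                 ∎
  where open ≡-Reasoning

negMod-* : ∀ a k c → negMod (a * suc c) (suc k * suc c) ≡ negMod a (suc k) * suc c
negMod-* a k c = begin
  (m * C ∸ (a * C) % (m * C)) % (m * C) ≡⟨ cong (λ r → (m * C ∸ r) % (m * C)) (m%n*o≡m*o%[n*o] a m C) ⟨
  (m * C ∸ (a % m) * C) % (m * C)       ≡⟨ cong (_% (m * C)) (*-distribʳ-∸ C m (a % m)) ⟨
  ((m ∸ a % m) * C) % (m * C)           ≡⟨ m%n*o≡m*o%[n*o] (m ∸ a % m) m C ⟨
  ((m ∸ a % m) % m) * C                 ∎
  where
  open ≡-Reasoning
  m = suc k
  C = suc c

posTail-≤ : ∀ n a c → posTail n a c ≤ c
posTail-≤ zero    a c       = z≤n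
posTail-≤ (suc n) a zero    = z≤n
posTail-≤ (suc n) a (suc k) =
  s≤s (≤-trans (posTail-≤ n (suc k) (negMod a (suc k))) (≤-pred (negMod-< a k)))

posTail-fuel : ∀ n m a c → c < n → c < m → posTail n a c ≡ posTail m a c
posTail-fuel (suc n) (suc m) a zero    _       _       = refl
posTail-fuel (suc n) (suc m) a (suc k) (s≤s c<n) (s≤s c<m) =
  cong suc (posTail-fuel n m (suc k) (negMod a (suc k))
    (<-≤-trans (negMod-< a k) c<n) (<-≤-trans (negMod-< a k) c<m))

posTail-* : ∀ n a x c → posTail n (a * suc c) (x * suc c) ≡ posTail n a x
posTail-* zero    a x       c = refl
posTail-* (suc n) a zero    c = refl
posTail-* (suc n) a (suc k) c = cong suc (begin
  posTail n (suc k * suc c) (negMod (a * suc c) (suc k * suc c))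
    ≡⟨ cong (posTail n (suc k * suc c)) (negMod-* a k c) ⟩
  posTail n (suc k * suc c) (negMod a (suc k) * suc c)
    ≡⟨ posTail-* n (suc k) (negMod a (suc k)) c ⟩
  posTail n (suc k) (negMod a (suc k)) ∎)
  where open ≡-Reasoning

posCount : ℕ → ℕ → ℕ
posCount x y = posTail (suc y) x y

posCount-≤ : ∀ x y → posCount x y ≤ y
posCount-≤ x y = posTail-≤ (suc y) x y

posCount-step : ∀ x y → 0 < y → posCount x y ≡ suc (posCount y (negMod x y))
posCount-step x (suc k) _ = cong suc
  (posTail-fuel (suc k) (suc (negMod x (suc k))) (suc k) (negMod x (suc k)) (negMod-< x k) ≤-refl)

posCount-+ˡ : ∀ y a → 0 < y → posCount (y + a) y ≡ posCount a y
posCount-+ˡ y a 0<y = begin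
  posCount (y + a) y                  ≡⟨ posCount-step (y + a) y 0<y ⟩
  suc (posCount y (negMod (y + a) y)) ≡⟨ cong (suc ∘ posCount y) (negMod-+ˡ y a) ⟩
  suc (posCount y (negMod a y))       ≡⟨ posCount-step a y 0<y ⟨
  posCount a y                        ∎
  where open ≡-Reasoning

posCount-*-≤ : ∀ a x c → posCount (a * suc c) (x * suc c) ≤ x
posCount-*-≤ a x c rewrite posTail-* (suc (x * suc c)) a x c = posTail-≤ _ a x

ProductBound : ℕ → ℕ → Set
ProductBound y d = suc (posCount (y + d) y * posCount (y + d) d) ≤ y + d

productBound-sym : ∀ {y d} → ProductBound y d → ProductBound d y
productBound-sym {y} {d} bound
  rewrite +-comm d y | *-comm (posCount (y + d) d) (posCount (y + d) y) = bound

productBound-diag : ∀ y → 0 < y → ProductBound y y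
productBound-diag y 0<y
  rewrite posCount-step (y + y) y 0<y | negMod-+ˡ y y | negMod-self y = +-mono-≤ 0<y 0<y

productBound-step : ∀ y s → 0 < y → 0 < s → ProductBound y s → ProductBound y (y + s)
productBound-step y s 0<y 0<s bound = begin
  suc (posCount (y + (y + s)) y * posCount (y + (y + s)) (y + s))
    ≡⟨ cong₂ (λ p q → suc (p * q)) (posCount-+ˡ y (y + s) 0<y) first-step ⟩
  suc (A * suc B) ≡⟨ cong suc (*-suc A B) ⟩
  suc (A + A * B) ≡⟨ +-suc A (A * B) ⟨
  A + suc (A * B) ≤⟨ +-mono-≤ (posCount-≤ (y + s) y) bound ⟩
  y + (y + s)     ∎
  where
  open ≤-Reasoning
  A = posCount (y + s) y
  B = posCount (y + s) s
  first-step : posCount (y + (y + s)) (y + s) ≡ suc B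
  first-step = begin-equality
    posCount (y + (y + s)) (y + s)
      ≡⟨ posCount-step (y + (y + s)) (y + s) (<-≤-trans 0<y (m≤m+n y s)) ⟩
    suc (posCount (y + s) (negMod (y + (y + s)) (y + s)))
      ≡⟨ cong (suc ∘ posCount (y + s)) (negMod-+ y (y + s) 0<y (m<m+n y 0<s)) ⟩
    suc (posCount (y + s) (y + s ∸ y))
      ≡⟨ cong (suc ∘ posCount (y + s)) (m+n∸m≡n y s) ⟩
    suc B ∎

productBound-acc : ∀ y d → Acc _<_ (y + d) → 0 < y → 0 < d → ProductBound y d
productBound-acc y d (acc rec) 0<y 0<d with compare y d
... | less .y k = subst (ProductBound y) (+-suc y k)
  (productBound-step y (suc k) 0<y z<s (productBound-acc y (suc k) (rec smaller) 0<y z<s))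
  where
  smaller : y + suc k < y + suc (y + k)
  smaller = +-monoʳ-< y (s<s (m<n+m k 0<y))
... | equal .y = productBound-diag y 0<y
... | greater .d k = productBound-sym (subst (ProductBound d) (+-suc d k)
  (productBound-step d (suc k) 0<d z<s (productBound-acc d (suc k) (rec smaller) 0<d z<s)))
  where
  smaller : d + suc k < suc (d + k) + d
  smaller = subst (_< suc (d + k) + d) (sym (+-suc d k)) (m<m+n (suc (d + k)) 0<d)

productBound : ∀ N ε → 0 < ε → ε < N → suc (posCount N ε * posCount N (N ∸ ε)) ≤ N
productBound N ε 0<ε ε<N =
  subst (λ M → suc (posCount M ε * posCount M (N ∸ ε)) ≤ M) (m+[n∸m]≡n (<⇒≤ ε<N))
    (productBound-acc ε (N ∸ ε) (<-wellFounded _) 0<ε (m<n⇒0<n∸m ε<N))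

∑< : ℕ → (ℕ → ℕ) → ℕ
∑< zero    f = 0
∑< (suc n) f = f 0 + ∑< n (f ∘ suc)

∑<-suc : ∀ n (f : ℕ → ℕ) → ∑< (suc n) f ≡ ∑< n f + f n
∑<-suc zero    f = +-comm (f 0) 0
∑<-suc (suc n) f = trans (cong (f 0 +_) (∑<-suc n (f ∘ suc))) (sym (+-assoc (f 0) _ _))

∑<-+ : ∀ n (f g : ℕ → ℕ) → ∑< n (λ i → f i + g i) ≡ ∑< n f + ∑< n g
∑<-+ zero    f g = refl
∑<-+ (suc n) f g = trans (cong (f 0 + g 0 +_) (∑<-+ n (f ∘ suc) (g ∘ suc)))
  (interchange (f 0) (g 0) (∑< n (f ∘ suc)) (∑< n (g ∘ suc)))
  where
  interchange : ∀ a b c d → (a + b) + (c + d) ≡ (a + c) + (b + d)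
  interchange = solve-∀

∑<-+-split : ∀ m n (f : ℕ → ℕ) → ∑< (m + n) f ≡ ∑< m f + ∑< n (λ i → f (m + i))
∑<-+-split zero    n f = refl
∑<-+-split (suc m) n f =
  trans (cong (f 0 +_) (∑<-+-split m n (f ∘ suc))) (sym (+-assoc (f 0) _ _))

∑<-reverse : ∀ n (f : ℕ → ℕ) → ∑< n (λ i → f (n ∸ i)) ≡ ∑< n (f ∘ suc)
∑<-reverse zero    f = refl
∑<-reverse (suc n) f = begin
  f (suc n) + ∑< n (λ i → f (n ∸ i)) ≡⟨ cong (f (suc n) +_) (∑<-reverse n f) ⟩
  f (suc n) + ∑< n (f ∘ suc)         ≡⟨ +-comm (f (suc n)) _ ⟩
  ∑< n (f ∘ suc) + f (suc n)         ≡⟨ ∑<-suc n (f ∘ suc) ⟨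
  ∑< (suc n) (f ∘ suc)               ∎
  where open ≡-Reasoning

∑<-shift-≤ : ∀ n (f : ℕ → ℕ) → f n ≤ f 0 → ∑< n (f ∘ suc) ≤ ∑< n f
∑<-shift-≤ n f fn≤f0 = +-cancelʳ-≤ (f 0) _ _ (begin
  ∑< n (f ∘ suc) + f 0 ≡⟨ +-comm _ (f 0) ⟩
  ∑< (suc n) f         ≡⟨ ∑<-suc n f ⟩
  ∑< n f + f n         ≤⟨ +-monoʳ-≤ (∑< n f) fn≤f0 ⟩
  ∑< n f + f 0         ∎)
  where open ≤-Reasoning

n≤∑< : ∀ n (g : ℕ → ℕ) → (∀ i → i < n → 1 ≤ g i) → n ≤ ∑< n g
n≤∑< zero    g g≥1 = z≤n
n≤∑< (suc n) g g≥1 = +-mono-≤ (g≥1 0 z<s) (n≤∑< n (g ∘ suc) (λ i i<n → g≥1 (suc i) (s<s i<n)))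

∑<-blocks : ∀ m q (g : ℕ → ℕ) → (∀ i → i < q * suc m → 1 ≤ g i) →
            (∀ j → j < q → 2 ≤ g (j * suc m)) → q * suc m + q ≤ ∑< (q * suc m) g
∑<-blocks m zero    g g≥1 g≥2 = z≤n
∑<-blocks m (suc q) g g≥1 g≥2 = begin
  (suc m + q * suc m) + suc q ≡⟨ rearrange m (q * suc m) q ⟩
  suc (suc m) + (q * suc m + q)
    ≤⟨ +-mono-≤ first-block (∑<-blocks m q (λ i → g (suc m + i))
         (λ i i<q → g≥1 (suc m + i) (+-monoʳ-< (suc m) i<q)) (λ j j<q → g≥2 (suc j) (s<s j<q))) ⟩
  ∑< (suc m) g + ∑< (q * suc m) (λ i → g (suc m + i)) ≡⟨ ∑<-+-split (suc m) (q * suc m) g ⟨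
  ∑< (suc m + q * suc m) g ∎
  where
  open ≤-Reasoning
  rearrange : ∀ m Q q → (suc m + Q) + suc q ≡ suc (suc m) + (Q + q)
  rearrange = solve-∀
  first-block : suc (suc m) ≤ ∑< (suc m) g
  first-block = +-mono-≤ (g≥2 0 z<s)
    (n≤∑< m (g ∘ suc) (λ i i<m → g≥1 (suc i) (≤-trans (s<s i<m) (m≤m+n (suc m) (q * suc m)))))

indicator : ∀ {a} {A : Set a} → Dec A → ℕ
indicator d = if does d then 1 else 0

indicator-≥ : ∀ {a} {A : Set a} (d : Dec A) → A → 1 ≤ indicator d
indicator-≥ (yes _) _ = ≤-refl
indicator-≥ (no ¬a) a = contradiction a ¬a

indicator-≤ : ∀ {a} {A : Set a} (d : Dec A) → indicator d ≤ 1
indicator-≤ (yes _) = ≤-refl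
indicator-≤ (no _)  = z≤n

length-filter-applyUpTo : ∀ {ℓ} {P : Pred ℕ ℓ} (P? : Decidable P) n (g : ℕ → ℕ) →
  length (filter P? (applyUpTo g n)) ≡ ∑< n (λ i → indicator (P? (g i)))
length-filter-applyUpTo P? zero    g = refl
length-filter-applyUpTo P? (suc n) g with does (P? (g 0))
... | true  = cong suc (length-filter-applyUpTo P? n (g ∘ suc))
... | false = length-filter-applyUpTo P? n (g ∘ suc)

m≤n+n⇒m/2≤n : ∀ {m n} → m ≤ n + n → m / 2 ≤ n
m≤n+n⇒m/2≤n {m} {n} m≤n+n = begin
  m / 2       ≤⟨ /-monoˡ-≤ 2 m≤n+n ⟩
  (n + n) / 2 ≡⟨ cong (_/ 2) (trans (cong (n +_) (sym (+-identityʳ n))) (*-comm 2 n)) ⟩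
  n * 2 / 2   ≡⟨ m*n/n≡m n 2 ⟩
  n           ∎
  where open ≤-Reasoning

module GoodValues (b′ : ℕ) where
  private
    b = suc b′
    N = b * b

  good? : Decidable (λ ε → F N ε ≤ b + 2)
  good? ε = F N ε ≤? b + 2

  isGood : ℕ → ℕ
  isGood ε = indicator (good? ε)

  bad⇒b≤posCount : ∀ ε → ¬ F N ε ≤ b + 2 → b ≤ posCount N ε
  bad⇒b≤posCount ε bad = ≤-trans (m≤m+n b 2) (≤-pred (≰⇒> bad))

  good-or-complement-good : ∀ ε → ε < N → F N ε ≤ b + 2 ⊎ F N (N ∸ ε) ≤ b + 2
  good-or-complement-good zero      _   = inj₁ (s≤s z≤n)
  good-or-complement-good ε@(suc _) ε<N with good? ε | good? (N ∸ ε)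
  ... | yes good | _        = inj₁ good
  ... | no _     | yes good = inj₂ good
  ... | no bad   | no bad′  = contradiction
    (≤-trans (productBound N ε z<s ε<N)
             (*-mono-≤ (bad⇒b≤posCount ε bad) (bad⇒b≤posCount (N ∸ ε) bad′)))
    1+n≰n

  multiple-good : ∀ j → j ≤ b → F N (j * b) ≤ b + 2
  multiple-good j j≤b = ≤-trans (s≤s (≤-trans (posCount-*-≤ b j b′) j≤b))
                                (≤-trans (n≤1+n (suc b)) (≤-reflexive (+-comm 2 b)))

  isGoodPair : ℕ → ℕ
  isGoodPair ε = isGood ε + isGood (N ∸ ε)

  isGoodPair-≥1 : ∀ ε → ε < N → 1 ≤ isGoodPair ε
  isGoodPair-≥1 ε ε<N with good-or-complement-good ε ε<N
  ... | inj₁ good = ≤-trans (indicator-≥ (good? ε) good) (m≤m+n _ _)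
  ... | inj₂ good = ≤-trans (indicator-≥ (good? (N ∸ ε)) good) (m≤n+m _ _)

  isGoodPair-multiple : ∀ j → j < b → 2 ≤ isGoodPair (j * b)
  isGoodPair-multiple j j<b = +-mono-≤
    (indicator-≥ (good? (j * b)) (multiple-good j (<⇒≤ j<b)))
    (indicator-≥ (good? (N ∸ j * b))
      (subst (λ ε → F N ε ≤ b + 2) (*-distribʳ-∸ b b j) (multiple-good (b ∸ j) (m∸n≤m b j))))

  ∑isGoodPair-≤ : ∑< N isGoodPair ≤ ∑< N isGood + ∑< N isGood
  ∑isGoodPair-≤ = begin
    ∑< N isGoodPair                            ≡⟨ ∑<-+ N isGood (λ ε → isGood (N ∸ ε)) ⟩
    ∑< N isGood + ∑< N (λ ε → isGood (N ∸ ε)) ≡⟨ cong (∑< N isGood +_) (∑<-reverse N isGood) ⟩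
    ∑< N isGood + ∑< N (isGood ∘ suc)
      -- isGood 0 computes to 1, as F N 0 = 1.
      ≤⟨ +-monoʳ-≤ (∑< N isGood) (∑<-shift-≤ N isGood (indicator-≤ (good? N))) ⟩
    ∑< N isGood + ∑< N isGood                  ∎
    where open ≤-Reasoning

  b²+b≤2*goodCount : N + b ≤ goodCount b + goodCount b
  b²+b≤2*goodCount = subst (λ c → N + b ≤ c + c) (sym (length-filter-applyUpTo good? N id))
    (≤-trans (∑<-blocks b′ b isGoodPair isGoodPair-≥1 isGoodPair-multiple) ∑isGoodPair-≤)

lemma4p7 : (b : ℕ) → 2 ≤ b → (b * b + b) / 2 ≤ goodCount b
lemma4p7 (suc b′) _ = m≤n+n⇒m/2≤n (GoodValues.b²+b≤2*goodCount b′)
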